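{- Let $\delta>0$ be a constant and $p=1/2$. Then asymptotically almost surely (i.e. with probability tending to $1$ as $n\to\infty$) the random graph $G(n,1/2)$ satisfies $$w(G(n,1/2)) \ge (1-\delta)\log_2 n .$$
   Context: $G(n,p)$ is the random graph on $n$ labeled vertices in which each of the $\binom n2$ possible edges is present independently with probability $p$. All graphs are simple. A graph homomorphism $\phi:G\to H$ is a map $V(G)\to V(H)$ sending edges to edges; $\mathrm{Hom}(G,H)$ denotes the set of homomorphisms. For $d\ge 0$, $T^d$ is the infinite rooted tree in which the root has $d$ children and every other vertex also has exactly $d$ children. A map $\varphi\in\mathrm{Hom}(T^d,G)$ is called cold if there is a vertex $a$ of $G$ such that for every $k$ there is no $\psi\in\mathrm{Hom}(T^d,G)$ that agrees with $\varphi$ on all vertices at distance $k$ from the root $r$ and has $\psi(r)=a$. A graph $G$ is $d$-warm if $\mathrm{Hom}(T^{d-2},G)$ contains no cold maps, and the warmth $w(G)$ is the largest $d$ for which $G$ is $d$-warm. -}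

module Defs where

open import Data.Nat using (ℕ; zero; suc; _+_; _*_; _∸_; _^_; _≤_; _<_)
open import Data.Nat.Combinatorics using (_C_)
open import Data.Fin as Fin using (Fin)
open import Data.Bool using (Bool; true; false)
open import Data.List using (List; []; _∷_; length)
open import Data.List.Relation.Unary.All using (All)
open import Data.List.Relation.Unary.AllPairs using (AllPairs)
open import Data.Product using (Σ; ∃; _×_; _,_)
open import Data.Sum using (_⊎_)
open import Relation.Binary.PropositionalEquality using (_≡_; _≢_)
open import Relation.Nullary using (¬_)

-- A simple graph on the labeled vertex set Fin n, given by its edge indicator
-- on unordered pairs {i,j} (encoded as i < j).  There are exactly 2^(n C 2)
-- such graphs (up to pointwise equality).
record Graph (n : ℕ) : Set where
  constructor mkGraph
  field
    edge : (i j : Fin n) → i Fin.< j → Bool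
open Graph public

Adj : ∀ {n} → Graph n → Fin n → Fin n → Set
Adj G u v = (Σ (u Fin.< v) λ h → edge G u v h ≡ true)
          ⊎ (Σ (v Fin.< u) λ h → edge G v u h ≡ true)

Different : ∀ {n} → Graph n → Graph n → Set
Different G H = Σ _ λ i → Σ _ λ j → Σ (i Fin.< j) λ h → edge G i j h ≢ edge H i j h

-- The infinite rooted d-ary tree T^d: vertices are finite words over Fin d
-- (the path from the root); the root is [], the children of v are i ∷ v,
-- and the distance of v from the root is length v.
TVert : ℕ → Set
TVert d = List (Fin d)

Hom : (d : ℕ) → ∀ {n} → Graph n → Set
Hom d {n} G = Σ (TVert d → Fin n) λ φ → ∀ (v : TVert d) (i : Fin d) → Adj G (φ v) (φ (i ∷ v))

Cold : ∀ {d n} (G : Graph n) → Hom d G → Set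
Cold {d} {n} G (φ , _) =
  Σ (Fin n) λ a → ∀ (k : ℕ) →
    ¬ (Σ (Hom d G) λ ψ →
         (∀ (v : TVert d) → length v ≡ k → Data.Product.proj₁ ψ v ≡ φ v)
         × Data.Product.proj₁ ψ [] ≡ a)

Warm : (d : ℕ) → ∀ {n} → Graph n → Set
Warm d G = (φ : Hom (d ∸ 2) G) → ¬ Cold G φ

-- w(G) ≥ (1 - a/b) log₂ n, i.e. G is d-warm for some d ≥ 2 with
-- d ≥ (1 - a/b) log₂ n, which (for b > 0) is  n^(b-a) ≤ 2^(d·b)
-- (when a ≥ b the right-hand side bound is ≤ 0 and only d ≥ 2 is asked).
WarmthAtLeast : (a b : ℕ) → ∀ {n} → Graph n → Set
WarmthAtLeast a b {n} G = Σ ℕ λ d → 2 ≤ d × Warm d G × (n ^ (b ∸ a) ≤ 2 ^ (d * b))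

-- If every set of at most d − 1 vertices of G has a common neighbour, then G is d-warm: a
-- homomorphism T^(d−2) → G can be re-rooted at any vertex a by keeping it from level 2 on and
-- sending each level-1 vertex to a common neighbour of a and the images of its children.
-- For a fixed m-set S the events "w is a common neighbour of S" (w ∉ S) are independent, each of
-- probability 2^(−m), so by a union bound at most a fraction n^m (1 − 2^(−m))^(n−m) of the graphs
-- on n vertices have an m-set without a common neighbour.  This independence is established by
-- counting, with induction on n that deletes vertex 0; when 0 ∈ S its neighbourhood becomes an
-- extra constraint, a mask, on the remaining candidates.
-- Finally, for 2^(bq) ≤ n < 2^(b(q+1)) take m = (b − a)(q + 1) + 1 ≈ (1 − a/b) log₂ n.  Then
-- 2^m ≤ 2^(bq + b − q), so (n − m)/2^m is about 2^(q−b) while log₂(e n^m) = O(q²), and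
-- (1 − 1/M)^M ≤ 1/2 bounds the bad fraction by n^m 2^(−⌊(n−m)/2^m⌋) ≤ 1/e ≤ c/e.

module Submission where

open import Defs
open import Data.Nat using (ℕ; _*_; _∸_; _^_; _≤_; _<_)
open import Data.Nat.Combinatorics using (_C_)
open import Data.List using (List; length)
open import Data.List.Relation.Unary.All using (All)
open import Data.List.Relation.Unary.AllPairs using (AllPairs)
open import Data.Product using (Σ; _×_)

open import Data.Bool as Bool using (Bool; true; false)
open import Data.Fin as Fin using (Fin)
import Data.Fin.Properties as Fin
open import Data.List using ([]; _∷_; _++_; [_]; map; filter; cartesianProductWith; allFin)
import Data.List.Properties as List
import Data.List.Relation.Unary.All as All
import Data.List.Relation.Unary.All.Properties as All
import Data.List.Relation.Unary.Any as Any
import Data.List.Relation.Unary.Any.Properties as Any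
import Data.List.Relation.Unary.AllPairs as AllPairs
import Data.List.Relation.Unary.AllPairs.Properties as AllPairs
open import Data.List.Membership.Propositional using (_∈_; _∉_; find)
open import Data.List.Membership.Propositional.Properties using (∈-allFin)
open import Data.Nat using (zero; suc; _+_; z≤n; s≤s; z<s; s≤s⁻¹; NonZero; >-nonZero; _<?_)
open import Data.Nat.DivMod using (_/_; _%_; m≡m%n+[m/n]*n; m*n/n≡m; /-monoˡ-≤)
open import Data.Nat.Combinatorics using (nC1≡n; nCk+nC[k+1]≡[n+1]C[k+1])
open import Data.Nat.Properties
open import Data.Nat.Tactic.RingSolver using (solve-∀)
open import Algebra.Properties.CommutativeSemigroup +-commutativeSemigroup using (interchange)
open import Data.Product using (_,_; proj₁; proj₂)
open import Data.Sum using (inj₁; inj₂)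
open import Data.Vec as Vec using (Vec; []; _∷_; lookup)
open import Data.Vec.Properties using (length-toList)
import Data.Vec.Relation.Unary.All as VecAll
open import Relation.Binary.PropositionalEquality hiding ([_])
open import Relation.Nullary using (¬_; Dec; yes; no; contradiction)
open import Relation.Nullary.Decidable using (_×-dec_; _⊎-dec_; ¬?)
open import Relation.Unary using (Decidable)
open import Function using (_∘_; id; flip)


∑ : {A : Set} → List A → (A → ℕ) → ℕ
∑ []       f = 0
∑ (x ∷ xs) f = f x + ∑ xs f

syntax ∑ xs (λ x → e) = ∑[ x ∈ xs ] e

module _ {A : Set} where

  ∑-cong : ∀ (xs : List A) {f g : A → ℕ} → (∀ x → f x ≡ g x) → ∑ xs f ≡ ∑ xs g
  ∑-cong []       f≡g = refl
  ∑-cong (x ∷ xs) f≡g = cong₂ _+_ (f≡g x) (∑-cong xs f≡g)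

  ∑-mono-≤ : ∀ (xs : List A) {f g : A → ℕ} → (∀ x → f x ≤ g x) → ∑ xs f ≤ ∑ xs g
  ∑-mono-≤ []       f≤g = z≤n
  ∑-mono-≤ (x ∷ xs) f≤g = +-mono-≤ (f≤g x) (∑-mono-≤ xs f≤g)

  ∑-distrib-+ : ∀ (xs : List A) (f g : A → ℕ) → ∑[ x ∈ xs ] (f x + g x) ≡ ∑ xs f + ∑ xs g
  ∑-distrib-+ []       f g = refl
  ∑-distrib-+ (x ∷ xs) f g =
    trans (cong (f x + g x +_) (∑-distrib-+ xs f g)) (interchange (f x) (g x) (∑ xs f) (∑ xs g))

  ∑-*ˡ : ∀ (xs : List A) c (f : A → ℕ) → ∑[ x ∈ xs ] (c * f x) ≡ c * ∑ xs f
  ∑-*ˡ []       c f = sym (*-zeroʳ c)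
  ∑-*ˡ (x ∷ xs) c f = trans (cong (c * f x +_) (∑-*ˡ xs c f)) (sym (*-distribˡ-+ c (f x) (∑ xs f)))

  ∑-*ʳ : ∀ (xs : List A) c (f : A → ℕ) → ∑[ x ∈ xs ] (f x * c) ≡ ∑ xs f * c
  ∑-*ʳ []       c f = refl
  ∑-*ʳ (x ∷ xs) c f = trans (cong (f x * c +_) (∑-*ʳ xs c f)) (sym (*-distribʳ-+ c (f x) (∑ xs f)))

  ∑-const : ∀ (xs : List A) c → ∑[ x ∈ xs ] c ≡ length xs * c
  ∑-const []       c = refl
  ∑-const (x ∷ xs) c = cong (c +_) (∑-const xs c)

  ∑-++ : ∀ (xs ys : List A) (f : A → ℕ) → ∑ (xs ++ ys) f ≡ ∑ xs f + ∑ ys f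
  ∑-++ []       ys f = refl
  ∑-++ (x ∷ xs) ys f = trans (cong (f x +_) (∑-++ xs ys f)) (sym (+-assoc (f x) _ _))

  ∈⇒≤∑ : ∀ {xs : List A} {x} (f : A → ℕ) → x ∈ xs → f x ≤ ∑ xs f
  ∈⇒≤∑ f (Any.here refl)         = m≤m+n _ _
  ∈⇒≤∑ {y ∷ _} f (Any.there x∈xs) = ≤-trans (∈⇒≤∑ f x∈xs) (m≤n+m _ (f y))

module _ {A B : Set} where

  ∑-map : ∀ (h : A → B) (xs : List A) (f : B → ℕ) → ∑ (map h xs) f ≡ ∑[ x ∈ xs ] f (h x)
  ∑-map h []       f = refl
  ∑-map h (x ∷ xs) f = cong (f (h x) +_) (∑-map h xs f)

  ∑-comm : ∀ (xs : List A) (ys : List B) (f : A → B → ℕ) →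
           ∑[ x ∈ xs ] ∑[ y ∈ ys ] f x y ≡ ∑[ y ∈ ys ] ∑[ x ∈ xs ] f x y
  ∑-comm []       ys f = sym (trans (∑-const ys 0) (*-zeroʳ (length ys)))
  ∑-comm (x ∷ xs) ys f = trans (cong (∑ ys (f x) +_) (∑-comm xs ys f)) (sym (∑-distrib-+ ys (f x) _))

module _ {A B C : Set} (f : A → B → C) where

  ∑-cartesianProductWith : ∀ (xs : List A) (ys : List B) (g : C → ℕ) →
    ∑ (cartesianProductWith f xs ys) g ≡ ∑[ x ∈ xs ] ∑[ y ∈ ys ] g (f x y)
  ∑-cartesianProductWith []       ys g = refl
  ∑-cartesianProductWith (x ∷ xs) ys g = trans (∑-++ (map (f x) ys) _ g)
    (cong₂ _+_ (∑-map (f x) ys g) (∑-cartesianProductWith xs ys g))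

  length-cartesianProductWith : ∀ (xs : List A) (ys : List B) →
    length (cartesianProductWith f xs ys) ≡ length xs * length ys
  length-cartesianProductWith []       ys = refl
  length-cartesianProductWith (x ∷ xs) ys = trans (List.length-++ (map (f x) ys))
    (cong₂ _+_ (List.length-map (f x) ys) (length-cartesianProductWith xs ys))

  AllPairs-cartesianProductWith⁺ : ∀ {R₁ : A → A → Set} {R₂ : B → B → Set} {R : C → C → Set} →
    (∀ {x x′ y y′} → R₁ x x′ → R (f x y) (f x′ y′)) → (∀ {x y y′} → R₂ y y′ → R (f x y) (f x y′)) →
    ∀ {xs ys} → AllPairs R₁ xs → AllPairs R₂ ys → AllPairs R (cartesianProductWith f xs ys)
  AllPairs-cartesianProductWith⁺ sep₁ sep₂ AllPairs.[] _ = AllPairs.[]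
  AllPairs-cartesianProductWith⁺ sep₁ sep₂ {x ∷ xs} {ys} (Rx AllPairs.∷ Rxs) Rys =
    AllPairs.++⁺ (AllPairs.map⁺ (AllPairs.map sep₂ Rys))
      (AllPairs-cartesianProductWith⁺ sep₁ sep₂ Rxs Rys)
      (All.map⁺ (All.tabulate λ _ →
        All.cartesianProductWith⁺ (setoid A) (setoid B) f xs ys (λ x′∈xs _ → sep₁ (All.lookup Rx x′∈xs))))

χ : {P : Set} → Dec P → ℕ
χ (yes _) = 1
χ (no _)  = 0

χ≤1 : ∀ {P : Set} (p? : Dec P) → χ p? ≤ 1
χ≤1 (yes _) = s≤s z≤n
χ≤1 (no _)  = z≤n

χ-yes : ∀ {P : Set} (p? : Dec P) → P → χ p? ≡ 1
χ-yes (yes _) _ = refl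
χ-yes (no ¬p) p = contradiction p ¬p

χ-mono : ∀ {P Q : Set} (p? : Dec P) (q? : Dec Q) → (P → Q) → χ p? ≤ χ q?
χ-mono (yes _) (yes _) _   = ≤-refl
χ-mono (yes p) (no ¬q) p⇒q = contradiction (p⇒q p) ¬q
χ-mono (no _)  _       _   = z≤n

χ-× : ∀ {P Q : Set} (p? : Dec P) (q? : Dec Q) → χ (p? ×-dec q?) ≡ χ p? * χ q?
χ-× (yes _) (yes _) = refl
χ-× (yes _) (no _)  = refl
χ-× (no _)  _       = refl

χ-mono-× : ∀ {P Q R : Set} (p? : Dec P) (q? : Dec Q) (r? : Dec R) → (P → Q × R) → χ p? ≤ χ q? * χ r?
χ-mono-× p? q? r? p⇒q×r = ≤-trans (χ-mono p? (q? ×-dec r?) p⇒q×r) (≤-reflexive (χ-× q? r?))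

χ+χ¬≡1 : ∀ {P : Set} (p? : Dec P) → χ p? + χ (¬? p?) ≡ 1
χ+χ¬≡1 (yes _) = refl
χ+χ¬≡1 (no _)  = refl

length-filter : ∀ {A : Set} {P : A → Set} (P? : Decidable P) (xs : List A) →
                length (filter P? xs) ≡ ∑[ x ∈ xs ] χ (P? x)
length-filter P? []       = refl
length-filter P? (x ∷ xs) with P? x
... | yes _ = cong suc (length-filter P? xs)
... | no _  = length-filter P? xs

union-bound : ∀ {A : Set} {P : A → Set} (P? : Decidable P) (xs : List A) →
              χ (¬? (All.all? P? xs)) ≤ ∑[ x ∈ xs ] χ (¬? (P? x))
union-bound P? xs with All.all? P? xs
... | yes _    = z≤n
... | no ¬all with find (All.¬All⇒Any¬ P? xs ¬all)
...   | x , x∈xs , ¬px = ≤-trans (≤-reflexive (sym (χ-yes (¬? (P? x)) ¬px))) (∈⇒≤∑ (χ ∘ ¬? ∘ P?) x∈xs)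


boolVecs : (n : ℕ) → List (Vec Bool n)
boolVecs zero    = [ [] ]
boolVecs (suc n) = cartesianProductWith _∷_ (true ∷ false ∷ []) (boolVecs n)

length-boolVecs : ∀ n → length (boolVecs n) ≡ 2 ^ n
length-boolVecs zero    = refl
length-boolVecs (suc n) = trans (length-cartesianProductWith _∷_ (true ∷ false ∷ []) (boolVecs n))
                                (cong (2 *_) (length-boolVecs n))

∑-boolVecs-suc : ∀ n (f : Vec Bool (suc n) → ℕ) →
  ∑ (boolVecs (suc n)) f ≡ ∑[ v ∈ boolVecs n ] f (true ∷ v) + ∑[ v ∈ boolVecs n ] f (false ∷ v)
∑-boolVecs-suc n f = trans (∑-cartesianProductWith _∷_ (true ∷ false ∷ []) (boolVecs n) f)
                           (cong (∑[ v ∈ boolVecs n ] f (true ∷ v) +_) (+-identityʳ _))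

Apart : ∀ {n} → Vec Bool n → Vec Bool n → Set
Apart {n} u v = Σ (Fin n) λ i → lookup u i ≢ lookup v i

boolVecs-apart : ∀ n → AllPairs Apart (boolVecs n)
boolVecs-apart zero    = All.[] AllPairs.∷ AllPairs.[]
boolVecs-apart (suc n) = AllPairs-cartesianProductWith⁺ _∷_
  (λ b≢b′ → Fin.zero , b≢b′) (λ (i , u≢v) → Fin.suc i , u≢v)
  (((λ ()) All.∷ All.[]) AllPairs.∷ All.[] AllPairs.∷ AllPairs.[]) (boolVecs-apart n)

extend : ∀ {n} → Graph n → Vec Bool n → Graph (suc n)
extend {n} G v = mkGraph e
  where
  e : (i j : Fin (suc n)) → i Fin.< j → Bool
  e Fin.zero    (Fin.suc j) _       = lookup v j
  e (Fin.suc i) (Fin.suc j) (s≤s h) = edge G i j h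

graphs : (n : ℕ) → List (Graph n)
graphs zero    = [ mkGraph (λ ()) ]
graphs (suc n) = cartesianProductWith extend (graphs n) (boolVecs n)

length-graphs-suc : ∀ n → length (graphs (suc n)) ≡ length (graphs n) * 2 ^ n
length-graphs-suc n = trans (length-cartesianProductWith extend (graphs n) (boolVecs n))
                            (cong (length (graphs n) *_) (length-boolVecs n))

length-graphs : ∀ n → length (graphs n) ≡ 2 ^ (n C 2)
length-graphs zero    = refl
length-graphs (suc n) = begin
  length (graphs (suc n))          ≡⟨ length-graphs-suc n ⟩
  length (graphs n) * 2 ^ n        ≡⟨ cong (_* 2 ^ n) (length-graphs n) ⟩
  2 ^ (n C 2) * 2 ^ n              ≡⟨ ^-distribˡ-+-* 2 (n C 2) n ⟨
  2 ^ (n C 2 + n)                  ≡⟨ cong (λ k → 2 ^ (n C 2 + k)) (nC1≡n n) ⟨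
  2 ^ (n C 2 + n C 1)              ≡⟨ cong (2 ^_) (+-comm (n C 2) (n C 1)) ⟩
  2 ^ (n C 1 + n C 2)              ≡⟨ cong (2 ^_) (nCk+nC[k+1]≡[n+1]C[k+1] n 1) ⟩
  2 ^ (suc n C 2)                  ∎
  where open ≡-Reasoning

graphs-different : ∀ n → AllPairs Different (graphs n)
graphs-different zero    = All.[] AllPairs.∷ AllPairs.[]
graphs-different (suc n) = AllPairs-cartesianProductWith⁺ extend
  (λ (i , j , i<j , e≢e′) → Fin.suc i , Fin.suc j , s≤s i<j , e≢e′)
  (λ (k , u≢v) → Fin.zero , Fin.suc k , s≤s z≤n , u≢v)
  (graphs-different n) (boolVecs-apart n)

Masks : ℕ → ℕ → Set
Masks n r = Vec (Vec Bool n) r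

masks : (n r : ℕ) → List (Masks n r)
masks n zero    = [ [] ]
masks n (suc r) = cartesianProductWith _∷_ (boolVecs n) (masks n r)

length-masks : ∀ n r → length (masks n r) ≡ (2 ^ n) ^ r
length-masks n zero    = refl
length-masks n (suc r) = trans (length-cartesianProductWith _∷_ (boolVecs n) (masks n r))
                               (cong₂ _*_ (length-boolVecs n) (length-masks n r))

∑-masks-column : ∀ n r (f : Masks (suc n) r → ℕ) →
  ∑ (masks (suc n) r) f ≡ ∑[ bs ∈ boolVecs r ] ∑[ ts ∈ masks n r ] f (Vec.zipWith _∷_ bs ts)
∑-masks-column n zero    f = sym (+-identityʳ _)
∑-masks-column n (suc r) f = begin
  ∑ (masks (suc n) (suc r)) f
    ≡⟨ ∑-cartesianProductWith _∷_ (boolVecs (suc n)) (masks (suc n) r) f ⟩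
  ∑[ t ∈ boolVecs (suc n) ] ∑[ ts ∈ masks (suc n) r ] f (t ∷ ts)
    ≡⟨ ∑-boolVecs-suc n _ ⟩
  row true + row false
    ≡⟨ cong₂ _+_ (row≡ true) (row≡ false) ⟩
  ∑[ bs ∈ boolVecs r ] g (true ∷ bs) + ∑[ bs ∈ boolVecs r ] g (false ∷ bs)
    ≡⟨ ∑-boolVecs-suc r g ⟨
  ∑ (boolVecs (suc r)) g ∎
  where
  open ≡-Reasoning
  g : Vec Bool (suc r) → ℕ
  g bs = ∑[ ts ∈ masks n (suc r) ] f (Vec.zipWith _∷_ bs ts)
  row : Bool → ℕ
  row b = ∑[ v ∈ boolVecs n ] ∑[ ts ∈ masks (suc n) r ] f ((b ∷ v) ∷ ts)
  row≡ : ∀ b → row b ≡ ∑[ bs ∈ boolVecs r ] g (b ∷ bs)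
  row≡ b = begin
    row b
      ≡⟨ ∑-cong (boolVecs n) (λ v → ∑-masks-column n r _) ⟩
    ∑[ v ∈ boolVecs n ] ∑[ bs ∈ boolVecs r ] ∑[ ts ∈ masks n r ] f ((b ∷ v) ∷ Vec.zipWith _∷_ bs ts)
      ≡⟨ ∑-comm (boolVecs n) (boolVecs r) _ ⟩
    ∑[ bs ∈ boolVecs r ] ∑[ v ∈ boolVecs n ] ∑[ ts ∈ masks n r ] f ((b ∷ v) ∷ Vec.zipWith _∷_ bs ts)
      ≡⟨ ∑-cong (boolVecs r) (λ bs → ∑-cartesianProductWith _∷_ (boolVecs n) (masks n r) _) ⟨
    ∑[ bs ∈ boolVecs r ] g (b ∷ bs) ∎

tuples : (n m : ℕ) → List (Vec (Fin n) m)
tuples n zero    = [ [] ]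
tuples n (suc m) = cartesianProductWith _∷_ (allFin n) (tuples n m)

∈-tuples : ∀ {n m} (s : Vec (Fin n) m) → s ∈ tuples n m
∈-tuples []      = Any.here refl
∈-tuples (x ∷ s) = Any.cartesianProductWith⁺ _∷_ (λ { refl refl → refl }) (∈-allFin x) (∈-tuples s)

length-tuples : ∀ n m → length (tuples n m) ≡ n ^ m
length-tuples n zero    = refl
length-tuples n (suc m) = trans (length-cartesianProductWith _∷_ (allFin n) (tuples n m))
                                (cong₂ _*_ (List.length-tabulate {n = n} id) (length-tuples n m))


-- Common neighbours give warmth

Adj-sym : ∀ {n} (G : Graph n) {u v} → Adj G u v → Adj G v u
Adj-sym G (inj₁ e) = inj₂ e
Adj-sym G (inj₂ e) = inj₁ e

adj? : ∀ {n} (G : Graph n) (u v : Fin n) → Dec (Adj G u v)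
adj? G u v = edge? u v ⊎-dec edge? v u
  where
  edge? : ∀ u v → Dec (Σ (u Fin.< v) λ h → edge G u v h ≡ true)
  edge? u v with u Fin.<? v
  ... | no u≮v = no λ (h , _) → u≮v h
  ... | yes h with edge G u v h Bool.≟ true
  ...   | yes e = yes (h , e)
  ...   | no ¬e = no λ (h′ , e) → ¬e (subst (λ h″ → edge G u v h″ ≡ true) (<-irrelevant h′ h) e)

HasCommonNeighbour : ∀ {n} → Graph n → List (Fin n) → Set
HasCommonNeighbour {n} G s = Σ (Fin n) λ w → All (Adj G w) s

hasCommonNeighbour? : ∀ {n} (G : Graph n) (s : List (Fin n)) → Dec (HasCommonNeighbour G s)
hasCommonNeighbour? G s = Fin.any? λ w → All.all? (adj? G w) s

Good : ∀ {n} → ℕ → Graph n → Set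
Good {n} m G = All (HasCommonNeighbour G ∘ Vec.toList) (tuples n m)

good? : ∀ {n} m (G : Graph n) → Dec (Good m G)
good? {n} m G = All.all? (hasCommonNeighbour? G ∘ Vec.toList) (tuples n m)

All-toList-tabulate⁻ : ∀ {A : Set} {P : A → Set} {D} (g : Fin D → A) →
                       All P (Vec.toList (Vec.tabulate g)) → ∀ j → P (g j)
All-toList-tabulate⁻ g (p All.∷ ps) Fin.zero    = p
All-toList-tabulate⁻ g (p All.∷ ps) (Fin.suc j) = All-toList-tabulate⁻ (g ∘ Fin.suc) ps j

good⇒warm : ∀ {n} d (G : Graph n) → Good (suc (d ∸ 2)) G → Warm d G
good⇒warm {n} d G good (φ , φ-hom) (a , cold) = cold 2 ((ψ , ψ-hom) , ψ≡φ , refl)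
  where
  D = d ∸ 2
  star : Fin D → Vec (Fin n) (suc D)
  star i = a ∷ Vec.tabulate (λ j → φ (j ∷ i ∷ []))
  hub : Fin D → Fin n
  hub i = proj₁ (All.lookup good (∈-tuples (star i)))
  hub-adj : ∀ i → All (Adj G (hub i)) (Vec.toList (star i))
  hub-adj i = proj₂ (All.lookup good (∈-tuples (star i)))
  ψ : TVert D → Fin n
  ψ []                = a
  ψ (i ∷ [])          = hub i
  ψ v@(_ ∷ _ ∷ _)     = φ v
  ψ-hom : ∀ v i → Adj G (ψ v) (ψ (i ∷ v))
  ψ-hom []              i = Adj-sym G (All.head (hub-adj i))
  ψ-hom (i′ ∷ [])       i = All-toList-tabulate⁻ _ (All.tail (hub-adj i′)) i
  ψ-hom v@(_ ∷ _ ∷ _)   i = φ-hom v i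
  ψ≡φ : ∀ v → length v ≡ 2 → ψ v ≡ φ v
  ψ≡φ (_ ∷ _ ∷ []) _ = refl


-- Counting graphs in which a set has no common neighbour

module _ {n} (G : Graph n) (v : Vec Bool n) where

  extend-adj-zero : ∀ {j} → lookup v j ≡ true → Adj (extend G v) Fin.zero (Fin.suc j)
  extend-adj-zero e = inj₁ (s≤s z≤n , e)

  extend-adj-suc : ∀ {i j} → Adj G i j → Adj (extend G v) (Fin.suc i) (Fin.suc j)
  extend-adj-suc (inj₁ (h , e)) = inj₁ (s≤s h , e)
  extend-adj-suc (inj₂ (h , e)) = inj₂ (s≤s h , e)

-- Masks record the neighbourhoods of deleted vertices of s (noWitness-extend-∈), so a witness
-- must lie in every mask.
Allowed : ∀ {n r} → Masks n r → Fin n → Set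
Allowed ts w = VecAll.All (λ t → lookup t w ≡ true) ts

Witness : ∀ {n r} → Graph n → Masks n r → List (Fin n) → Fin n → Set
Witness G ts s w = w ∉ s × All (Adj G w) s × Allowed ts w

NoWitness : ∀ {n r} → Graph n → Masks n r → List (Fin n) → Set
NoWitness G ts s = ∀ w → ¬ Witness G ts s w

noWitness? : ∀ {n r} (G : Graph n) (ts : Masks n r) (s : List (Fin n)) → Dec (NoWitness G ts s)
noWitness? G ts s = Fin.all? λ w → ¬? (¬? (Any.any? (w Fin.≟_) s)
  ×-dec All.all? (adj? G w) s ×-dec VecAll.all? (λ t → lookup t w Bool.≟ true) ts)

stripZero : ∀ {n} → List (Fin (suc n)) → List (Fin n)
stripZero []               = []
stripZero (Fin.zero ∷ s)   = stripZero s
stripZero (Fin.suc x ∷ s)  = x ∷ stripZero s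

All-stripZero : ∀ {n} {P : Fin (suc n) → Set} (s : List (Fin (suc n))) →
                (Fin.zero ∈ s → P Fin.zero) → All (P ∘ Fin.suc) (stripZero s) → All P s
All-stripZero []              P0 Ps           = All.[]
All-stripZero (Fin.zero ∷ s)  P0 Ps           = P0 (Any.here refl) All.∷ All-stripZero s (P0 ∘ Any.there) Ps
All-stripZero (Fin.suc x ∷ s) P0 (Px All.∷ Ps) = Px All.∷ All-stripZero s (P0 ∘ Any.there) Ps

∈-stripZero : ∀ {n} (s : List (Fin (suc n))) {w} → Fin.suc w ∈ s → w ∈ stripZero s
∈-stripZero (Fin.zero ∷ s)  (Any.there w∈s) = ∈-stripZero s w∈s
∈-stripZero (Fin.suc x ∷ s) (Any.here refl) = Any.here refl
∈-stripZero (Fin.suc x ∷ s) (Any.there w∈s) = Any.there (∈-stripZero s w∈s)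

length-stripZero-∉ : ∀ {n} (s : List (Fin (suc n))) → Fin.zero ∉ s → length (stripZero s) ≡ length s
length-stripZero-∉ []              _   = refl
length-stripZero-∉ (Fin.zero ∷ s)  0∉s = contradiction (Any.here refl) 0∉s
length-stripZero-∉ (Fin.suc x ∷ s) 0∉s = cong suc (length-stripZero-∉ s (0∉s ∘ Any.there))

length-stripZero-≤ : ∀ {n} (s : List (Fin (suc n))) → length (stripZero s) ≤ length s
length-stripZero-≤ []              = z≤n
length-stripZero-≤ (Fin.zero ∷ s)  = m≤n⇒m≤1+n (length-stripZero-≤ s)
length-stripZero-≤ (Fin.suc x ∷ s) = s≤s (length-stripZero-≤ s)

length-stripZero-∈ : ∀ {n} (s : List (Fin (suc n))) → Fin.zero ∈ s → length (stripZero s) < length s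
length-stripZero-∈ (Fin.zero ∷ s)  _                = s≤s (length-stripZero-≤ s)
length-stripZero-∈ (Fin.suc x ∷ s) (Any.there 0∈s) = s≤s (length-stripZero-∈ s 0∈s)

Covers : ∀ {n} → Vec Bool n → List (Fin n) → Set
Covers v s = All (λ y → lookup v y ≡ true) s

covers? : ∀ {n} (v : Vec Bool n) (s : List (Fin n)) → Dec (Covers v s)
covers? v s = All.all? (λ y → lookup v y Bool.≟ true) s

AllTrue : ∀ {r} → Vec Bool r → Set
AllTrue = VecAll.All (_≡ true)

allTrue? : ∀ {r} (bs : Vec Bool r) → Dec (AllTrue bs)
allTrue? = VecAll.all? (Bool._≟ true)

allowed-zero : ∀ {n r} (bs : Vec Bool r) (ts : Masks n r) → AllTrue bs →
               Allowed (Vec.zipWith _∷_ bs ts) Fin.zero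
allowed-zero []       []       VecAll.[]            = VecAll.[]
allowed-zero (b ∷ bs) (t ∷ ts) (b≡true VecAll.∷ ok) = b≡true VecAll.∷ allowed-zero bs ts ok

allowed-suc : ∀ {n r} (bs : Vec Bool r) (ts : Masks n r) {w : Fin n} → Allowed ts w →
              Allowed (Vec.zipWith _∷_ bs ts) (Fin.suc w)
allowed-suc []       []       VecAll.[]         = VecAll.[]
allowed-suc (b ∷ bs) (t ∷ ts) (tw VecAll.∷ ok) = tw VecAll.∷ allowed-suc bs ts ok

noWitness-extend-∉ : ∀ {n r} (G : Graph n) (v : Vec Bool n) (bs : Vec Bool r) (ts : Masks n r)
  (s : List (Fin (suc n))) → Fin.zero ∉ s → NoWitness (extend G v) (Vec.zipWith _∷_ bs ts) s →
  ¬ (Covers v (stripZero s) × AllTrue bs) × NoWitness G ts (stripZero s)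
noWitness-extend-∉ G v bs ts s 0∉s none =
  (λ (cov , true-bs) → none Fin.zero
    (0∉s , All-stripZero s (flip contradiction 0∉s) (All.map (extend-adj-zero G v) cov)
         , allowed-zero bs ts true-bs)) ,
  (λ w (w∉s′ , adj , ok) → none (Fin.suc w)
    (w∉s′ ∘ ∈-stripZero s , All-stripZero s (flip contradiction 0∉s) (All.map (extend-adj-suc G v) adj)
    , allowed-suc bs ts ok))

noWitness-extend-∈ : ∀ {n r} (G : Graph n) (v : Vec Bool n) (bs : Vec Bool r) (ts : Masks n r)
  (s : List (Fin (suc n))) → Fin.zero ∈ s → NoWitness (extend G v) (Vec.zipWith _∷_ bs ts) s →
  NoWitness G (v ∷ ts) (stripZero s)
noWitness-extend-∈ G v bs ts s 0∈s none w (w∉s′ , adj , (vw VecAll.∷ ok)) = none (Fin.suc w)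
  (w∉s′ ∘ ∈-stripZero s , All-stripZero s (λ _ → Adj-sym (extend G v) (extend-adj-zero G v vw))
                                          (All.map (extend-adj-suc G v) adj)
  , allowed-suc bs ts ok)

badCount : (n r : ℕ) → List (Fin n) → ℕ
badCount n r s = ∑[ G ∈ graphs n ] ∑[ ts ∈ masks n r ] χ (noWitness? G ts s)

badCount≤total : ∀ n r s → badCount n r s ≤ length (graphs n) * (2 ^ n) ^ r
badCount≤total n r s = begin
  badCount n r s
    ≤⟨ ∑-mono-≤ (graphs n) (λ G → ∑-mono-≤ (masks n r) (λ ts → χ≤1 (noWitness? G ts s))) ⟩
  ∑[ G ∈ graphs n ] ∑[ ts ∈ masks n r ] 1
    ≡⟨ ∑-cong (graphs n) (λ _ → trans (∑-const (masks n r) 1) (*-identityʳ _)) ⟩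
  ∑[ G ∈ graphs n ] length (masks n r)
    ≡⟨ ∑-const (graphs n) _ ⟩
  length (graphs n) * length (masks n r)
    ≡⟨ cong (length (graphs n) *_) (length-masks n r) ⟩
  length (graphs n) * (2 ^ n) ^ r ∎
  where open ≤-Reasoning

badCount-suc : ∀ n r (s : List (Fin (suc n))) → badCount (suc n) r s ≡
  ∑[ G ∈ graphs n ] ∑[ v ∈ boolVecs n ] ∑[ bs ∈ boolVecs r ] ∑[ ts ∈ masks n r ]
    χ (noWitness? (extend G v) (Vec.zipWith _∷_ bs ts) s)
badCount-suc n r s = trans (∑-cartesianProductWith extend (graphs n) (boolVecs n) _)
  (∑-cong (graphs n) λ G → ∑-cong (boolVecs n) λ v → ∑-masks-column n r _)

-- Choices (v, bs) of the neighbourhood of a new vertex 0 and of its bits in the r masks for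
-- which 0 is not a witness for s.
missCount : (n r : ℕ) → List (Fin n) → ℕ
missCount n r s = ∑[ v ∈ boolVecs n ] ∑[ bs ∈ boolVecs r ] χ (¬? (covers? v s ×-dec allTrue? bs))

covers-count : ∀ n (s : List (Fin n)) → 2 ^ n ≤ ∑[ v ∈ boolVecs n ] χ (covers? v s) * 2 ^ length s
covers-count zero    []      = ≤-refl
covers-count (suc n) s = begin
  2 * 2 ^ n                          ≤⟨ *-monoʳ-≤ 2 (covers-count n s′) ⟩
  2 * (X′ * 2 ^ length s′)           ≤⟨ split (Any.any? (Fin.zero Fin.≟_) s) ⟩
  (X true + X false) * 2 ^ length s  ≡⟨ cong (_* 2 ^ length s) (∑-boolVecs-suc n _) ⟨
  ∑ (boolVecs (suc n)) (λ v → χ (covers? v s)) * 2 ^ length s ∎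
  where
  open ≤-Reasoning
  s′ = stripZero s
  X′ = ∑[ v ∈ boolVecs n ] χ (covers? v s′)
  X : Bool → ℕ
  X b = ∑[ v ∈ boolVecs n ] χ (covers? (b ∷ v) s)
  X′≤X : ∀ b → (Fin.zero ∈ s → b ≡ true) → X′ ≤ X b
  X′≤X b b≡ = ∑-mono-≤ (boolVecs n) λ v → χ-mono _ _ (All-stripZero s b≡)
  split : Dec (Fin.zero ∈ s) → 2 * (X′ * 2 ^ length s′) ≤ (X true + X false) * 2 ^ length s
  split (yes 0∈s) = begin
    2 * (X′ * 2 ^ length s′)   ≡⟨ *-comm 2 (X′ * 2 ^ length s′) ⟩
    X′ * 2 ^ length s′ * 2     ≡⟨ *-assoc X′ (2 ^ length s′) 2 ⟩
    X′ * (2 ^ length s′ * 2)   ≡⟨ cong (X′ *_) (*-comm (2 ^ length s′) 2) ⟩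
    X′ * 2 ^ suc (length s′)   ≤⟨ *-mono-≤ (≤-trans (X′≤X true (λ _ → refl)) (m≤m+n _ _))
                                           (^-monoʳ-≤ 2 (length-stripZero-∈ s 0∈s)) ⟩
    (X true + X false) * 2 ^ length s ∎
  split (no 0∉s) = begin
    2 * (X′ * 2 ^ length s′)       ≡⟨ cong (λ k → 2 * (X′ * 2 ^ k)) (length-stripZero-∉ s 0∉s) ⟩
    2 * (X′ * 2 ^ length s)        ≡⟨ *-assoc 2 X′ _ ⟨
    (X′ + (X′ + 0)) * 2 ^ length s ≤⟨ *-monoˡ-≤ (2 ^ length s) (+-mono-≤ (X′≤X true (λ _ → refl))
                                       (≤-trans (≤-reflexive (+-identityʳ X′)) (X′≤X false (flip contradiction 0∉s)))) ⟩
    (X true + X false) * 2 ^ length s ∎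

allTrue-count : ∀ r → 1 ≤ ∑[ bs ∈ boolVecs r ] χ (allTrue? bs)
allTrue-count zero    = ≤-refl
allTrue-count (suc r) = begin
  1                                                  ≤⟨ allTrue-count r ⟩
  ∑[ bs ∈ boolVecs r ] χ (allTrue? bs)               ≤⟨ ∑-mono-≤ (boolVecs r) (λ bs → χ-mono _ _ (refl VecAll.∷_)) ⟩
  ∑[ bs ∈ boolVecs r ] χ (allTrue? (true ∷ bs))      ≤⟨ m≤m+n _ _ ⟩
  _                                                  ≡⟨ ∑-boolVecs-suc r _ ⟨
  ∑ (boolVecs (suc r)) (λ bs → χ (allTrue? bs))      ∎
  where open ≤-Reasoning

complement-scaled-≤ : ∀ {miss hit M A} → miss + hit ≡ M → M ≤ hit * A → miss * A ≤ M * (A ∸ 1)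
complement-scaled-≤ {miss} {hit} {M} {A} miss+hit≡M M≤hit*A = begin
  miss * A         ≡⟨ cong (_* A) (trans (cong (_∸ hit) (sym miss+hit≡M)) (m+n∸n≡m miss hit)) ⟨
  (M ∸ hit) * A    ≡⟨ *-distribʳ-∸ A M hit ⟩
  M * A ∸ hit * A  ≤⟨ ∸-monoʳ-≤ (M * A) M≤hit*A ⟩
  M * A ∸ M        ≡⟨ cong (M * A ∸_) (*-identityʳ M) ⟨
  M * A ∸ M * 1    ≡⟨ *-distribˡ-∸ M A 1 ⟨
  M * (A ∸ 1)      ∎
  where open ≤-Reasoning

missCount+hitCount : ∀ n r (s : List (Fin n)) →
  missCount n r s + ∑[ v ∈ boolVecs n ] χ (covers? v s) * ∑[ bs ∈ boolVecs r ] χ (allTrue? bs) ≡ 2 ^ n * 2 ^ r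
missCount+hitCount n r s = begin
  missCount n r s + X * Y
    ≡⟨ cong (missCount n r s +_) X*Y≡ ⟩
  missCount n r s + ∑[ v ∈ boolVecs n ] ∑[ bs ∈ boolVecs r ] χ (hit? v bs)
    ≡⟨ trans (∑-cong (boolVecs n) λ v → ∑-distrib-+ (boolVecs r) _ _) (∑-distrib-+ (boolVecs n) _ _) ⟨
  ∑[ v ∈ boolVecs n ] ∑[ bs ∈ boolVecs r ] (χ (¬? (hit? v bs)) + χ (hit? v bs))
    ≡⟨ ∑-cong (boolVecs n) (λ v → ∑-cong (boolVecs r) λ bs → trans (+-comm (χ (¬? (hit? v bs))) _) (χ+χ¬≡1 (hit? v bs))) ⟩
  ∑[ v ∈ boolVecs n ] ∑[ bs ∈ boolVecs r ] 1
    ≡⟨ trans (∑-cong (boolVecs n) λ _ → trans (∑-const (boolVecs r) 1) (*-identityʳ _)) (∑-const (boolVecs n) _) ⟩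
  length (boolVecs n) * length (boolVecs r)
    ≡⟨ cong₂ _*_ (length-boolVecs n) (length-boolVecs r) ⟩
  2 ^ n * 2 ^ r ∎
  where
  open ≡-Reasoning
  X = ∑[ v ∈ boolVecs n ] χ (covers? v s)
  Y = ∑[ bs ∈ boolVecs r ] χ (allTrue? bs)
  hit? : ∀ v bs → Dec (Covers v s × AllTrue bs)
  hit? v bs = covers? v s ×-dec allTrue? bs
  X*Y≡ : X * Y ≡ ∑[ v ∈ boolVecs n ] ∑[ bs ∈ boolVecs r ] χ (hit? v bs)
  X*Y≡ = begin
    X * Y
      ≡⟨ ∑-*ʳ (boolVecs n) Y (χ ∘ flip covers? s) ⟨
    ∑[ v ∈ boolVecs n ] (χ (covers? v s) * Y)
      ≡⟨ ∑-cong (boolVecs n) (λ v → ∑-*ˡ (boolVecs r) (χ (covers? v s)) (χ ∘ allTrue?)) ⟨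
    ∑[ v ∈ boolVecs n ] ∑[ bs ∈ boolVecs r ] (χ (covers? v s) * χ (allTrue? bs))
      ≡⟨ ∑-cong (boolVecs n) (λ v → ∑-cong (boolVecs r) λ bs → χ-× (covers? v s) (allTrue? bs)) ⟨
    ∑[ v ∈ boolVecs n ] ∑[ bs ∈ boolVecs r ] χ (hit? v bs) ∎

missCount-bound : ∀ n r (s : List (Fin n)) K → length s + r ≤ K →
  missCount n r s * 2 ^ K ≤ 2 ^ n * 2 ^ r * (2 ^ K ∸ 1)
missCount-bound n r s K ℓ+r≤K = complement-scaled-≤ {missCount n r s} {X * Y} (missCount+hitCount n r s) (begin
  2 ^ n * 2 ^ r               ≤⟨ *-monoˡ-≤ (2 ^ r) (covers-count n s) ⟩
  X * 2 ^ length s * 2 ^ r    ≡⟨ *-assoc X _ _ ⟩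
  X * (2 ^ length s * 2 ^ r)  ≡⟨ cong (X *_) (^-distribˡ-+-* 2 (length s) r) ⟨
  X * 2 ^ (length s + r)      ≤⟨ *-monoʳ-≤ X (^-monoʳ-≤ 2 ℓ+r≤K) ⟩
  X * 2 ^ K                   ≡⟨ cong (_* 2 ^ K) (*-identityʳ X) ⟨
  X * 1 * 2 ^ K               ≤⟨ *-monoˡ-≤ (2 ^ K) (*-monoʳ-≤ X (allTrue-count r)) ⟩
  X * Y * 2 ^ K               ∎)
  where
  open ≤-Reasoning
  X = ∑[ v ∈ boolVecs n ] χ (covers? v s)
  Y = ∑[ bs ∈ boolVecs r ] χ (allTrue? bs)

badCount-∉ : ∀ n r (s : List (Fin (suc n))) → Fin.zero ∉ s →
  badCount (suc n) r s ≤ missCount n r (stripZero s) * badCount n r (stripZero s)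
badCount-∉ n r s 0∉s = begin
  badCount (suc n) r s
    ≡⟨ badCount-suc n r s ⟩
  ∑[ G ∈ graphs n ] ∑[ v ∈ boolVecs n ] ∑[ bs ∈ boolVecs r ] ∑[ ts ∈ masks n r ]
    χ (noWitness? (extend G v) (Vec.zipWith _∷_ bs ts) s)
    ≤⟨ ∑-mono-≤ (graphs n) (λ G → ∑-mono-≤ (boolVecs n) λ v → ∑-mono-≤ (boolVecs r) λ bs → ∑-mono-≤ (masks n r) λ ts →
         χ-mono-× _ (¬? (covers? v s′ ×-dec allTrue? bs)) _ (noWitness-extend-∉ G v bs ts s 0∉s)) ⟩
  ∑[ G ∈ graphs n ] ∑[ v ∈ boolVecs n ] ∑[ bs ∈ boolVecs r ] ∑[ ts ∈ masks n r ] (miss v bs * χ (noWitness? G ts s′))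
    ≡⟨ ∑-cong (graphs n) (λ G → ∑-cong (boolVecs n) λ v → ∑-cong (boolVecs r) λ bs → ∑-*ˡ (masks n r) (miss v bs) _) ⟩
  ∑[ G ∈ graphs n ] ∑[ v ∈ boolVecs n ] ∑[ bs ∈ boolVecs r ] (miss v bs * bad G)
    ≡⟨ ∑-cong (graphs n) (λ G → trans (∑-cong (boolVecs n) λ v → ∑-*ʳ (boolVecs r) (bad G) _)
                                      (∑-*ʳ (boolVecs n) (bad G) _)) ⟩
  ∑[ G ∈ graphs n ] (missCount n r s′ * bad G)
    ≡⟨ ∑-*ˡ (graphs n) (missCount n r s′) bad ⟩
  missCount n r s′ * badCount n r s′ ∎
  where
  open ≤-Reasoning
  s′ = stripZero s
  miss : Vec Bool n → Vec Bool r → ℕ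
  miss v bs = χ (¬? (covers? v s′ ×-dec allTrue? bs))
  bad : Graph n → ℕ
  bad G = ∑[ ts ∈ masks n r ] χ (noWitness? G ts s′)

badCount-∈ : ∀ n r (s : List (Fin (suc n))) → Fin.zero ∈ s →
  badCount (suc n) r s ≤ 2 ^ r * badCount n (suc r) (stripZero s)
badCount-∈ n r s 0∈s = begin
  badCount (suc n) r s
    ≡⟨ badCount-suc n r s ⟩
  ∑[ G ∈ graphs n ] ∑[ v ∈ boolVecs n ] ∑[ bs ∈ boolVecs r ] ∑[ ts ∈ masks n r ]
    χ (noWitness? (extend G v) (Vec.zipWith _∷_ bs ts) s)
    ≤⟨ ∑-mono-≤ (graphs n) (λ G → ∑-mono-≤ (boolVecs n) λ v → ∑-mono-≤ (boolVecs r) λ bs → ∑-mono-≤ (masks n r) λ ts →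
         χ-mono _ _ (noWitness-extend-∈ G v bs ts s 0∈s)) ⟩
  ∑[ G ∈ graphs n ] ∑[ v ∈ boolVecs n ] ∑[ bs ∈ boolVecs r ] bad G v
    ≡⟨ ∑-cong (graphs n) (λ G → ∑-cong (boolVecs n) λ v →
         trans (∑-const (boolVecs r) _) (cong (_* bad G v) (length-boolVecs r))) ⟩
  ∑[ G ∈ graphs n ] ∑[ v ∈ boolVecs n ] (2 ^ r * bad G v)
    ≡⟨ ∑-cong (graphs n) (λ G → trans (∑-*ˡ (boolVecs n) (2 ^ r) (bad G))
         (cong (2 ^ r *_) (sym (∑-cartesianProductWith _∷_ (boolVecs n) (masks n r) _)))) ⟩
  ∑[ G ∈ graphs n ] (2 ^ r * ∑[ ts ∈ masks n (suc r) ] χ (noWitness? G ts s′))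
    ≡⟨ ∑-*ˡ (graphs n) (2 ^ r) _ ⟩
  2 ^ r * badCount n (suc r) s′ ∎
  where
  open ≤-Reasoning
  s′ = stripZero s
  bad : Graph n → Vec Bool n → ℕ
  bad G v = ∑[ ts ∈ masks n r ] χ (noWitness? G (v ∷ ts) s′)

^-distribʳ-* : ∀ m n r → (m * n) ^ r ≡ m ^ r * n ^ r
^-distribʳ-* m n zero    = refl
^-distribʳ-* m n (suc r) = trans (cong (m * n *_) (^-distribʳ-* m n r)) (*-*-interchange m n (m ^ r) (n ^ r))
  where
  *-*-interchange : ∀ a b c d → a * b * (c * d) ≡ a * c * (b * d)
  *-*-interchange = solve-∀

CountBound : (n r : ℕ) → List (Fin n) → ℕ → ℕ → Set
CountBound n r s K x =
  badCount n r s * (2 ^ K) ^ x ≤ length (graphs n) * (2 ^ n) ^ r * (2 ^ K ∸ 1) ^ x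

countBound-zero : ∀ n r s K → CountBound n r s K 0
countBound-zero n r s K =
  ≤-trans (≤-reflexive (*-identityʳ _)) (≤-trans (badCount≤total n r s) (≤-reflexive (sym (*-identityʳ _))))

total-suc : ∀ n r → length (graphs (suc n)) * (2 ^ suc n) ^ r ≡ length (graphs n) * 2 ^ n * (2 ^ r * (2 ^ n) ^ r)
total-suc n r = cong₂ _*_ (length-graphs-suc n) (^-distribʳ-* 2 (2 ^ n) r)

countBound-∉ : ∀ n r (s : List (Fin (suc n))) K x → Fin.zero ∉ s → length s + r ≤ K →
  CountBound n r (stripZero s) K x → CountBound (suc n) r s K (suc x)
countBound-∉ n r s K x 0∉s ℓ+r≤K IH = begin
  badCount (suc n) r s * (a * a ^ x)               ≤⟨ *-monoˡ-≤ (a * a ^ x) (badCount-∉ n r s 0∉s) ⟩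
  S * B * (a * a ^ x)                              ≡⟨ regroup₁ S B a (a ^ x) ⟩
  S * a * (B * a ^ x)                              ≤⟨ *-mono-≤ (missCount-bound n r s′ K ℓ′+r≤K) IH ⟩
  2 ^ n * 2 ^ r * b * (T * (2 ^ n) ^ r * b ^ x)    ≡⟨ regroup₂ T (2 ^ n) (2 ^ r) ((2 ^ n) ^ r) b (b ^ x) ⟩
  T * 2 ^ n * (2 ^ r * (2 ^ n) ^ r) * (b * b ^ x)  ≡⟨ cong (_* (b * b ^ x)) (total-suc n r) ⟨
  length (graphs (suc n)) * (2 ^ suc n) ^ r * b ^ suc x ∎
  where
  open ≤-Reasoning
  a = 2 ^ K
  b = 2 ^ K ∸ 1
  s′ = stripZero s
  S = missCount n r s′
  B = badCount n r s′
  T = length (graphs n)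
  ℓ′+r≤K : length s′ + r ≤ K
  ℓ′+r≤K = subst (λ ℓ → ℓ + r ≤ K) (sym (length-stripZero-∉ s 0∉s)) ℓ+r≤K
  regroup₁ : ∀ S B a y → S * B * (a * y) ≡ S * a * (B * y)
  regroup₁ = solve-∀
  regroup₂ : ∀ T p q t b y → p * q * b * (T * t * y) ≡ T * p * (q * t) * (b * y)
  regroup₂ = solve-∀

countBound-∈ : ∀ n r (s : List (Fin (suc n))) K x → Fin.zero ∈ s →
  CountBound n (suc r) (stripZero s) K x → CountBound (suc n) r s K x
countBound-∈ n r s K x 0∈s IH = begin
  badCount (suc n) r s * a ^ x                     ≤⟨ *-monoˡ-≤ (a ^ x) (badCount-∈ n r s 0∈s) ⟩
  2 ^ r * B * a ^ x                                ≡⟨ *-assoc (2 ^ r) B (a ^ x) ⟩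
  2 ^ r * (B * a ^ x)                              ≤⟨ *-monoʳ-≤ (2 ^ r) IH ⟩
  2 ^ r * (T * (2 ^ n * (2 ^ n) ^ r) * b ^ x)      ≡⟨ regroup (2 ^ r) T (2 ^ n) ((2 ^ n) ^ r) (b ^ x) ⟩
  T * 2 ^ n * (2 ^ r * (2 ^ n) ^ r) * b ^ x        ≡⟨ cong (_* b ^ x) (total-suc n r) ⟨
  length (graphs (suc n)) * (2 ^ suc n) ^ r * b ^ x ∎
  where
  open ≤-Reasoning
  a = 2 ^ K
  b = 2 ^ K ∸ 1
  B = badCount n (suc r) (stripZero s)
  T = length (graphs n)
  regroup : ∀ q T p t y → q * (T * (p * t) * y) ≡ T * p * (q * t) * y
  regroup = solve-∀

1+x≤1+n∸ℓ⇒x≤n∸ℓ : ∀ {x} n ℓ → suc x ≤ suc n ∸ ℓ → x ≤ n ∸ ℓ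
1+x≤1+n∸ℓ⇒x≤n∸ℓ {x} n ℓ h = subst (x ≤_) (pred[m∸n]≡m∸[1+n] (suc n) ℓ) (suc[m]≤n⇒m≤pred[n] h)

count-bound : ∀ n r (s : List (Fin n)) K x → length s + r ≤ K → x ≤ n ∸ length s → CountBound n r s K x
count-bound n       r s K zero    _     _  = countBound-zero n r s K
count-bound zero    r s K (suc x) _     x< = contradiction (≤-trans x< (≤-reflexive (0∸n≡0 (length s)))) λ ()
count-bound (suc n) r s K (suc x) ℓ+r≤K x< = step (Any.any? (Fin.zero Fin.≟_) s)
  where
  s′ = stripZero s
  step : Dec (Fin.zero ∈ s) → CountBound (suc n) r s K (suc x)
  step (yes 0∈s) = countBound-∈ n r s K (suc x) 0∈s (count-bound n (suc r) s′ K (suc x)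
    (≤-trans (≤-reflexive (+-suc (length s′) r)) (≤-trans (+-monoˡ-≤ r (length-stripZero-∈ s 0∈s)) ℓ+r≤K))
    (≤-trans x< (∸-monoʳ-≤ (suc n) (length-stripZero-∈ s 0∈s))))
  step (no 0∉s) = countBound-∉ n r s K x 0∉s ℓ+r≤K (count-bound n r s′ K x
    (subst (λ ℓ → ℓ + r ≤ K) (sym ℓ′≡ℓ) ℓ+r≤K)
    (subst (λ ℓ → x ≤ n ∸ ℓ) (sym ℓ′≡ℓ) (1+x≤1+n∸ℓ⇒x≤n∸ℓ n (length s) x<)))
    where ℓ′≡ℓ = length-stripZero-∉ s 0∉s

bad-graphs-bound : ∀ n m →
  ∑[ G ∈ graphs n ] χ (¬? (good? m G)) * (2 ^ m) ^ (n ∸ m) ≤ n ^ m * length (graphs n) * (2 ^ m ∸ 1) ^ (n ∸ m)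
bad-graphs-bound n m = begin
  ∑[ G ∈ graphs n ] χ (¬? (good? m G)) * P
    ≤⟨ *-monoˡ-≤ P (∑-mono-≤ (graphs n) λ G →
         ≤-trans (union-bound (hasCommonNeighbour? G ∘ Vec.toList) (tuples n m))
                 (∑-mono-≤ (tuples n m) (isolated⇒noWitness G))) ⟩
  ∑[ G ∈ graphs n ] ∑[ s ∈ tuples n m ] ∑[ ts ∈ masks n 0 ] χ (noWitness? G ts (Vec.toList s)) * P
    ≡⟨ cong (_* P) (∑-comm (graphs n) (tuples n m) _) ⟩
  ∑[ s ∈ tuples n m ] badCount n 0 (Vec.toList s) * P
    ≡⟨ ∑-*ʳ (tuples n m) P _ ⟨
  ∑[ s ∈ tuples n m ] (badCount n 0 (Vec.toList s) * P)
    ≤⟨ ∑-mono-≤ (tuples n m) (λ s → ≤-trans (count-bound-tuple s) (≤-reflexive (cong (_* Q) (*-identityʳ T)))) ⟩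
  ∑[ s ∈ tuples n m ] (T * Q)
    ≡⟨ trans (∑-const (tuples n m) _) (cong (_* (T * Q)) (length-tuples n m)) ⟩
  n ^ m * (T * Q)
    ≡⟨ *-assoc (n ^ m) T Q ⟨
  n ^ m * T * Q ∎
  where
  open ≤-Reasoning
  P = (2 ^ m) ^ (n ∸ m)
  Q = (2 ^ m ∸ 1) ^ (n ∸ m)
  T = length (graphs n)
  isolated⇒noWitness : ∀ G s → χ (¬? (hasCommonNeighbour? G (Vec.toList s))) ≤
                                 ∑[ ts ∈ masks n 0 ] χ (noWitness? G ts (Vec.toList s))
  isolated⇒noWitness G s = ≤-trans (χ-mono _ _ λ ¬cn w (_ , adj , _) → ¬cn (w , adj)) (m≤m+n _ 0)
  count-bound-tuple : ∀ (s : Vec (Fin n) m) → badCount n 0 (Vec.toList s) * P ≤ T * 1 * Q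
  count-bound-tuple s = count-bound n 0 (Vec.toList s) m (n ∸ m)
    (≤-reflexive (trans (+-identityʳ _) (length-toList s)))
    (≤-reflexive (cong (n ∸_) (sym (length-toList s))))

complement-fraction-≥ : ∀ {g b t} e c → g + b ≡ t → e * b ≤ c * t → (e ∸ c) * t ≤ e * g
complement-fraction-≥ {g} {b} {t} e c g+b≡t e*b≤c*t = begin
  (e ∸ c) * t        ≡⟨ *-distribʳ-∸ t e c ⟩
  e * t ∸ c * t      ≤⟨ ∸-monoʳ-≤ (e * t) e*b≤c*t ⟩
  e * t ∸ e * b      ≡⟨ cong (λ t′ → e * t′ ∸ e * b) g+b≡t ⟨
  e * (g + b) ∸ e * b ≡⟨ cong (_∸ e * b) (*-distribˡ-+ e g b) ⟩
  e * g + e * b ∸ e * b ≡⟨ m+n∸n≡m (e * g) (e * b) ⟩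
  e * g              ∎
  where open ≤-Reasoning

many-good-graphs : ∀ n m c e → e * n ^ m * (2 ^ m ∸ 1) ^ (n ∸ m) ≤ c * (2 ^ m) ^ (n ∸ m) →
  (e ∸ c) * 2 ^ (n C 2) ≤ e * length (filter (good? m) (graphs n))
many-good-graphs n m c e few-bad = begin
  (e ∸ c) * 2 ^ (n C 2)   ≡⟨ cong ((e ∸ c) *_) (length-graphs n) ⟨
  (e ∸ c) * T             ≤⟨ complement-fraction-≥ e c good+bad≡T e*bad≤c*T ⟩
  e * good                ≡⟨ cong (e *_) (length-filter (good? m) (graphs n)) ⟨
  e * length (filter (good? m) (graphs n)) ∎
  where
  open ≤-Reasoning
  T = length (graphs n)
  P = (2 ^ m) ^ (n ∸ m)
  Q = (2 ^ m ∸ 1) ^ (n ∸ m)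
  good = ∑[ G ∈ graphs n ] χ (good? m G)
  bad = ∑[ G ∈ graphs n ] χ (¬? (good? m G))
  good+bad≡T : good + bad ≡ T
  good+bad≡T = trans (sym (∑-distrib-+ (graphs n) _ _))
    (trans (∑-cong (graphs n) (χ+χ¬≡1 ∘ good? m)) (trans (∑-const (graphs n) 1) (*-identityʳ T)))
  regroup₁ : ∀ e x y z → e * (x * y * z) ≡ e * x * z * y
  regroup₁ = solve-∀
  regroup₂ : ∀ c x y → c * x * y ≡ c * y * x
  regroup₂ = solve-∀
  e*bad≤c*T : e * bad ≤ c * T
  e*bad≤c*T = *-cancelʳ-≤ (e * bad) (c * T) P {{m^n≢0 (2 ^ m) (n ∸ m) {{m^n≢0 2 m}}}} (begin
    e * bad * P              ≡⟨ *-assoc e bad P ⟩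
    e * (bad * P)            ≤⟨ *-monoʳ-≤ e (bad-graphs-bound n m) ⟩
    e * (n ^ m * T * Q)      ≡⟨ regroup₁ e (n ^ m) T Q ⟩
    e * n ^ m * Q * T        ≤⟨ *-monoˡ-≤ T few-bad ⟩
    c * P * T                ≡⟨ regroup₂ c P T ⟩
    c * T * P                ∎)


-- Asymptotics

log-bracket : ∀ B → 1 < B → ∀ n → 0 < n → Σ ℕ λ q → B ^ q ≤ n × n < B ^ suc q
log-bracket B 1<B (suc n) _ = bracket n
  where
  instance
    B≢0 : NonZero B
    B≢0 = >-nonZero (<-trans z<s 1<B)
  bracket : ∀ n → Σ ℕ λ q → B ^ q ≤ suc n × suc n < B ^ suc q
  bracket zero    = 0 , ≤-refl , ≤-trans 1<B (≤-reflexive (sym (*-identityʳ B)))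
  bracket (suc n) with bracket n
  ... | q , lo , hi with suc (suc n) <? B ^ suc q
  ...   | yes below = q , m≤n⇒m≤1+n lo , below
  ...   | no ¬below = suc q , ≮⇒≥ ¬below , ≤-<-trans hi
          (<-≤-trans (m<m*n (B ^ suc q) B {{m^n≢0 B (suc q)}} 1<B) (≤-reflexive (*-comm (B ^ suc q) B)))

^-cancelʳ-< : ∀ B .{{_ : NonZero B}} {x y} → B ^ x < B ^ y → x < y
^-cancelʳ-< B Bˣ<Bʸ = ≰⇒> λ y≤x → <⇒≱ Bˣ<Bʸ (^-monoʳ-≤ B y≤x)

n<2^n : ∀ n → n < 2 ^ n
n<2^n zero    = z<s
n<2^n (suc n) = +-mono-≤-< (m^n>0 2 n) (≤-trans (n<2^n n) (≤-reflexive (sym (+-identityʳ (2 ^ n)))))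

bernoulli : ∀ x k → x ^ k * (x + k) ≤ x * suc x ^ k
bernoulli x zero    = ≤-reflexive (trans (*-identityˡ (x + 0)) (trans (+-identityʳ x) (sym (*-identityʳ x))))
bernoulli x (suc k) = begin
  x * x ^ k * (x + suc k)                  ≤⟨ m≤m+n _ (x ^ k * k) ⟩
  x * x ^ k * (x + suc k) + x ^ k * k      ≡⟨ expand x (x ^ k) k ⟩
  suc x * (x ^ k * (x + k))                ≤⟨ *-monoʳ-≤ (suc x) (bernoulli x k) ⟩
  suc x * (x * suc x ^ k)                  ≡⟨ *-comm-middle x (suc x ^ k) ⟩
  x * (suc x * suc x ^ k)                  ∎
  where
  open ≤-Reasoning
  expand : ∀ x y k → x * y * (x + (1 + k)) + y * k ≡ (1 + x) * (y * (x + k))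
  expand = solve-∀
  *-comm-middle : ∀ x z → (1 + x) * (x * z) ≡ x * ((1 + x) * z)
  *-comm-middle = solve-∀

n^[1+n]*2≤[1+n]^[1+n] : ∀ n → n ^ suc n * 2 ≤ suc n ^ suc n
n^[1+n]*2≤[1+n]^[1+n] zero       = z≤n
n^[1+n]*2≤[1+n]^[1+n] n@(suc _) = *-cancelʳ-≤ (n ^ suc n * 2) (suc n ^ suc n) n (begin
  n ^ suc n * 2 * n         ≡⟨ *-assoc (n ^ suc n) 2 n ⟩
  n ^ suc n * (2 * n)       ≤⟨ *-monoʳ-≤ (n ^ suc n) (≤-trans (≤-reflexive (cong (n +_) (+-identityʳ n)))
                                                             (+-monoʳ-≤ n (n≤1+n n))) ⟩
  n ^ suc n * (n + suc n)   ≤⟨ bernoulli n (suc n) ⟩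
  n * suc n ^ suc n         ≡⟨ *-comm n _ ⟩
  suc n ^ suc n * n         ∎)
  where open ≤-Reasoning

[n∸1]^x*2^[x/n]≤n^x : ∀ M .{{_ : NonZero M}} x → (M ∸ 1) ^ x * 2 ^ (x / M) ≤ M ^ x
[n∸1]^x*2^[x/n]≤n^x M@(suc M′) x =
  subst (λ y → M′ ^ y * 2 ^ (x / M) ≤ M ^ y) (sym x≡) (blocks (x / M) (x % M))
  where
  x≡ : x ≡ x / M * M + x % M
  x≡ = trans (m≡m%n+[m/n]*n x M) (+-comm (x % M) _)
  regroup : ∀ a b c → a * b * (2 * c) ≡ a * 2 * (b * c)
  regroup = solve-∀
  blocks : ∀ j r → M′ ^ (j * M + r) * 2 ^ j ≤ M ^ (j * M + r)
  blocks zero    r = ≤-trans (≤-reflexive (*-identityʳ _)) (^-monoˡ-≤ r (n≤1+n M′))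
  blocks (suc j) r = begin
    M′ ^ (M + j * M + r) * 2 ^ suc j          ≡⟨ cong (λ y → M′ ^ y * 2 ^ suc j) (+-assoc M (j * M) r) ⟩
    M′ ^ (M + (j * M + r)) * (2 * 2 ^ j)      ≡⟨ cong (_* (2 * 2 ^ j)) (^-distribˡ-+-* M′ M (j * M + r)) ⟩
    M′ ^ M * M′ ^ (j * M + r) * (2 * 2 ^ j)   ≡⟨ regroup (M′ ^ M) (M′ ^ (j * M + r)) (2 ^ j) ⟩
    M′ ^ M * 2 * (M′ ^ (j * M + r) * 2 ^ j)   ≤⟨ *-mono-≤ (n^[1+n]*2≤[1+n]^[1+n] M′) (blocks j r) ⟩
    M ^ M * M ^ (j * M + r)                   ≡⟨ ^-distribˡ-+-* M M (j * M + r) ⟨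
    M ^ (M + (j * M + r))                     ≡⟨ cong (M ^_) (+-assoc M (j * M) r) ⟨
    M ^ (M + j * M + r)                       ∎
    where open ≤-Reasoning

K*[6K+14]²≤2^[6K+12] : ∀ K → 1 ≤ K → K * ((6 * K + 14) * (6 * K + 14)) ≤ 2 ^ (6 * K + 12)
K*[6K+14]²≤2^[6K+12] K 1≤K = begin
  K * ((6 * K + 14) * (6 * K + 14))   ≤⟨ *-mono-≤ (m≤m+n K 3) (*-mono-≤ 6K+14≤6t 6K+14≤6t) ⟩
  t * ((6 * t) * (6 * t))             ≡⟨ expand₁ t ⟩
  36 * (t * t * t)                    ≤⟨ *-monoˡ-≤ (t * t * t) 36≤t³ ⟩
  (t * t * t) * (t * t * t)           ≤⟨ *-mono-≤ t³≤X³ t³≤X³ ⟩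
  (X * X * X) * (X * X * X)           ≡⟨ expand₂ X ⟩
  X ^ 6                               ≡⟨ ^-*-assoc 2 (K + 2) 6 ⟩
  2 ^ ((K + 2) * 6)                   ≡⟨ cong (2 ^_) (expand₃ K) ⟩
  2 ^ (6 * K + 12)                    ∎
  where
  open ≤-Reasoning
  t = K + 3
  X = 2 ^ (K + 2)
  6K+14≤6t : 6 * K + 14 ≤ 6 * t
  6K+14≤6t = ≤-trans (+-monoʳ-≤ (6 * K) (m≤m+n 14 4)) (≤-reflexive (sym (*-distribˡ-+ 6 K 3)))
  t≤X : t ≤ X
  t≤X = ≤-trans (≤-reflexive (+-suc K 2)) (n<2^n (K + 2))
  t³≤X³ : t * t * t ≤ X * X * X
  t³≤X³ = *-mono-≤ (*-mono-≤ t≤X t≤X) t≤X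
  36≤t³ : 36 ≤ t * t * t
  36≤t³ = ≤-trans (m≤m+n 36 28) (*-mono-≤ (*-mono-≤ 4≤t 4≤t) 4≤t)
    where 4≤t = +-monoˡ-≤ 3 1≤K
  expand₁ : ∀ t → t * ((6 * t) * (6 * t)) ≡ 36 * (t * t * t)
  expand₁ = solve-∀
  expand₂ : ∀ X → (X * X * X) * (X * X * X) ≡ X * (X * (X * (X * (X * (X * 1)))))
  expand₂ = solve-∀
  expand₃ : ∀ K → (K + 2) * 6 ≡ 6 * K + 12
  expand₃ = solve-∀

K*[2+q]²≤2^q : ∀ K → 1 ≤ K → ∀ q → 6 * K + 12 ≤ q → K * ((2 + q) * (2 + q)) ≤ 2 ^ q
K*[2+q]²≤2^q K 1≤K q q₀≤q = subst (λ y → K * ((2 + y) * (2 + y)) ≤ 2 ^ y) (m+[n∸m]≡n q₀≤q) (above (q ∸ q₀))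
  where
  q₀ = 6 * K + 12
  [3+y]²≤2*[2+y]² : ∀ y → 1 ≤ y → (3 + y) * (3 + y) ≤ 2 * ((2 + y) * (2 + y))
  [3+y]²≤2*[2+y]² (suc y) _ = ≤-trans (m≤m+n _ (y * y + 4 * y + 2)) (≤-reflexive (expand y))
    where
    expand : ∀ y → (3 + suc y) * (3 + suc y) + (y * y + 4 * y + 2) ≡ 2 * ((2 + suc y) * (2 + suc y))
    expand = solve-∀
  above : ∀ i → K * ((2 + (q₀ + i)) * (2 + (q₀ + i))) ≤ 2 ^ (q₀ + i)
  above zero    = subst (λ y → K * ((2 + y) * (2 + y)) ≤ 2 ^ y) (sym (+-identityʳ q₀))
    (≤-trans (≤-reflexive (cong (λ z → K * (z * z)) (trans (+-comm 2 q₀) (+-assoc (6 * K) 12 2))))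
             (K*[6K+14]²≤2^[6K+12] K 1≤K))
  above (suc i) = subst (λ y → K * ((2 + y) * (2 + y)) ≤ 2 ^ y) (sym (+-suc q₀ i)) (begin
    K * ((3 + y) * (3 + y))       ≤⟨ *-monoʳ-≤ K ([3+y]²≤2*[2+y]² y 1≤y) ⟩
    K * (2 * ((2 + y) * (2 + y))) ≡⟨ *-comm-middle K ((2 + y) * (2 + y)) ⟩
    2 * (K * ((2 + y) * (2 + y))) ≤⟨ *-monoʳ-≤ 2 (above i) ⟩
    2 * 2 ^ y                     ∎)
    where
    open ≤-Reasoning
    y = q₀ + i
    1≤y : 1 ≤ y
    1≤y = ≤-trans (s≤s z≤n) (≤-trans (m≤n+m 12 (6 * K)) (m≤m+n q₀ i))
    *-comm-middle : ∀ K z → K * (2 * z) ≡ 2 * (K * z)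
    *-comm-middle = solve-∀

scaleThreshold : ℕ → ℕ → ℕ
scaleThreshold b e = 6 * ((e + 1 + b * b) * 2 ^ b) + 12

log-term-bound : ∀ b e β q → β < b → scaleThreshold b e ≤ q →
  suc (e + b * suc q * suc (β * suc q)) * 2 ^ suc (β * suc q) ≤ 2 ^ (b * q)
log-term-bound b e β q β<b q₀≤q = *-cancelʳ-≤ _ _ (2 ^ b) {{m^n≢0 2 b}} (begin
  suc Y * 2 ^ m * 2 ^ b     ≡⟨ *-right-comm (suc Y) (2 ^ m) (2 ^ b) ⟩
  suc Y * 2 ^ b * 2 ^ m     ≤⟨ *-monoˡ-≤ (2 ^ m) sY*2^b≤2^q ⟩
  2 ^ q * 2 ^ m             ≡⟨ ^-distribˡ-+-* 2 q m ⟨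
  2 ^ (q + m)               ≤⟨ ^-monoʳ-≤ 2 (≤-trans (≤-reflexive (+-suc q (β * u))) (*-monoˡ-≤ u β<b)) ⟩
  2 ^ (b * u)               ≡⟨ cong (2 ^_) (trans (*-suc b q) (+-comm b (b * q))) ⟩
  2 ^ (b * q + b)           ≡⟨ ^-distribˡ-+-* 2 (b * q) b ⟩
  2 ^ (b * q) * 2 ^ b       ∎)
  where
  open ≤-Reasoning
  u = suc q
  m = suc (β * u)
  Y = e + b * u * m
  X = (2 + q) * (2 + q)
  K = (e + 1 + b * b) * 2 ^ b
  m≤b*u : m ≤ b * u
  m≤b*u = ≤-trans (s≤s (m≤n+m (β * u) q)) (*-monoˡ-≤ u β<b)
  *-right-comm : ∀ a b c → a * b * c ≡ a * c * b
  *-right-comm = solve-∀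
  regroup : ∀ e b u → suc (e + b * u * (b * u)) ≡ e + 1 + b * b * (u * u)
  regroup = solve-∀
  sY≤ : suc Y ≤ (e + 1 + b * b) * X
  sY≤ = begin
    suc (e + b * u * m)           ≤⟨ s≤s (+-monoʳ-≤ e (*-monoʳ-≤ (b * u) m≤b*u)) ⟩
    suc (e + b * u * (b * u))     ≡⟨ regroup e b u ⟩
    e + 1 + b * b * (u * u)       ≤⟨ +-mono-≤ (m≤m*n (e + 1) X) (*-monoʳ-≤ (b * b) (*-mono-≤ (n≤1+n u) (n≤1+n u))) ⟩
    (e + 1) * X + b * b * X       ≡⟨ *-distribʳ-+ X (e + 1) (b * b) ⟨
    (e + 1 + b * b) * X           ∎
  sY*2^b≤2^q : suc Y * 2 ^ b ≤ 2 ^ q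
  sY*2^b≤2^q = begin
    suc Y * 2 ^ b                 ≤⟨ *-monoˡ-≤ (2 ^ b) sY≤ ⟩
    (e + 1 + b * b) * X * 2 ^ b   ≡⟨ *-right-comm (e + 1 + b * b) X (2 ^ b) ⟩
    K * X                         ≤⟨ K*[2+q]²≤2^q K 1≤K q q₀≤q ⟩
    2 ^ q                         ∎
    where 1≤K = *-mono-≤ (≤-trans (m≤n+m 1 e) (m≤m+n (e + 1) (b * b))) (m^n>0 2 b)

bad-fraction-small : ∀ b e β q n → β < b → scaleThreshold b e ≤ q → (2 ^ b) ^ q ≤ n → n < (2 ^ b) ^ suc q →
  let m = suc (β * suc q) in e * n ^ m * (2 ^ m ∸ 1) ^ (n ∸ m) ≤ (2 ^ m) ^ (n ∸ m)
bad-fraction-small b e β q n β<b q₀≤q lo hi = begin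
  e * n ^ m * (2 ^ m ∸ 1) ^ x   ≤⟨ *-monoˡ-≤ _ e*n^m≤2^j ⟩
  2 ^ j * (2 ^ m ∸ 1) ^ x       ≡⟨ *-comm (2 ^ j) _ ⟩
  (2 ^ m ∸ 1) ^ x * 2 ^ j       ≤⟨ [n∸1]^x*2^[x/n]≤n^x (2 ^ m) x ⟩
  (2 ^ m) ^ x                   ∎
  where
  open ≤-Reasoning
  u = suc q
  m = suc (β * u)
  x = n ∸ m
  instance
    2^m≢0 : NonZero (2 ^ m)
    2^m≢0 = m^n≢0 2 m
  j = x / 2 ^ m
  Y = e + b * u * m
  Y*2^m≤x : Y * 2 ^ m ≤ x
  Y*2^m≤x = m+n≤o⇒m≤o∸n (Y * 2 ^ m) (begin
    Y * 2 ^ m + m         ≤⟨ +-monoʳ-≤ (Y * 2 ^ m) (<⇒≤ (n<2^n m)) ⟩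
    Y * 2 ^ m + 2 ^ m     ≡⟨ +-comm (Y * 2 ^ m) (2 ^ m) ⟩
    suc Y * 2 ^ m         ≤⟨ log-term-bound b e β q β<b q₀≤q ⟩
    2 ^ (b * q)           ≡⟨ ^-*-assoc 2 b q ⟨
    (2 ^ b) ^ q           ≤⟨ lo ⟩
    n                     ∎)
  e*n^m≤2^j : e * n ^ m ≤ 2 ^ j
  e*n^m≤2^j = begin
    e * n ^ m                   ≤⟨ *-mono-≤ (<⇒≤ (n<2^n e)) (^-monoˡ-≤ m (<⇒≤ hi)) ⟩
    2 ^ e * ((2 ^ b) ^ u) ^ m   ≡⟨ cong (λ z → 2 ^ e * z ^ m) (^-*-assoc 2 b u) ⟩
    2 ^ e * (2 ^ (b * u)) ^ m   ≡⟨ cong (2 ^ e *_) (^-*-assoc 2 (b * u) m) ⟩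
    2 ^ e * 2 ^ (b * u * m)     ≡⟨ ^-distribˡ-+-* 2 e (b * u * m) ⟨
    2 ^ Y                       ≤⟨ ^-monoʳ-≤ 2 (subst (_≤ j) (m*n/n≡m Y (2 ^ m)) (/-monoˡ-≤ (2 ^ m) Y*2^m≤x)) ⟩
    2 ^ j                       ∎

warmth-exponent : ∀ b β q n → n < (2 ^ b) ^ suc q → n ^ β ≤ 2 ^ ((2 + β * suc q) * b)
warmth-exponent b β q n hi = begin
  n ^ β                          ≤⟨ ^-monoˡ-≤ β (<⇒≤ hi) ⟩
  ((2 ^ b) ^ suc q) ^ β          ≡⟨ cong (_^ β) (^-*-assoc 2 b (suc q)) ⟩
  (2 ^ (b * suc q)) ^ β          ≡⟨ ^-*-assoc 2 (b * suc q) β ⟩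
  2 ^ (b * suc q * β)            ≤⟨ ^-monoʳ-≤ 2 (≤-trans (m≤n+m _ (2 * b)) (≤-reflexive (expand b β (suc q)))) ⟩
  2 ^ ((2 + β * suc q) * b)      ∎
  where
  open ≤-Reasoning
  expand : ∀ b β u → 2 * b + b * u * β ≡ (2 + β * u) * b
  expand = solve-∀

good⇒warmthAtLeast : ∀ a b q {n} (G : Graph n) → n < (2 ^ b) ^ suc q →
  Good (suc ((b ∸ a) * suc q)) G → WarmthAtLeast a b G
good⇒warmthAtLeast a b q G n< good =
  d , s≤s (s≤s z≤n) , good⇒warm d G good , warmth-exponent b (b ∸ a) q _ n<
  where d = 2 + (b ∸ a) * suc q

theorem3p4 : (a b : ℕ) → 0 < a → 0 < b →
    (c e : ℕ) → 0 < c → 0 < e →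
    Σ ℕ λ N → (n : ℕ) → N ≤ n →
      Σ (List (Graph n)) λ L →
        AllPairs Different L × All (WarmthAtLeast a b) L
          × ((e ∸ c) * 2 ^ (n C 2) ≤ e * length L)
theorem3p4 a b 0<a 0<b c e 0<c _ = (2 ^ b) ^ Q , λ n N≤n →
  let q , lo , hi = log-bracket (2 ^ b) (^-monoʳ-< 2 (s≤s (s≤s z≤n)) 0<b) n (≤-trans (m^n>0 (2 ^ b) Q) N≤n)
      m = suc (β * suc q)
      Q≤q = s≤s⁻¹ (^-cancelʳ-< (2 ^ b) (≤-<-trans N≤n hi))
  in filter (good? m) (graphs n)
   , AllPairs.filter⁺ (good? m) (graphs-different n)
   , All.map (good⇒warmthAtLeast a b q _ hi) (All.all-filter (good? m) (graphs n))
   , many-good-graphs n m c e (≤-trans (bad-fraction-small b e β q n β<b Q≤q lo hi) (m≤n*m _ c {{>-nonZero 0<c}}))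
  where
  instance
    2^b≢0 : NonZero (2 ^ b)
    2^b≢0 = m^n≢0 2 b
  Q = scaleThreshold b e
  β = b ∸ a
  β<b : β < b
  β<b = ≤-<-trans (∸-monoʳ-≤ b 0<a) (∸-monoʳ-< z<s 0<b)
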